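{- Let $(G,\rho)$ be a reduced maximal Gallai multigraph, $H$ an induced subgraph of $G$, and suppose $H$ has the tree property for $n$. If $U\in\mathcal V_{n+1}$, then $\rho[U\,\mathrm{brt}(U)]=\mathrm{tc}(U)$, i.e. the union of the color sets $\rho[u\,\mathrm{brt}(U)]$ over $u\in U\setminus\{\mathrm{brt}(U)\}$ equals $\mathrm{tc}(U)$.
   Context: An edge-colored (complete, loopless) multigraph $(G,\rho)$ has a finite vertex set $\mathcal V\subseteq\mathbb N$, ordered by the usual order of $\mathbb N$, and assigns to each unordered pair of distinct vertices $u,v$ a nonempty finite set $\rho[uv]$ of colors (parallel edges have distinct colors). For vertex sets $U,W$ let $\rho[UW]=\bigcup\{\rho[uw]:u\in U,w\in W,u\ne w\}$; a single vertex $u$ is identified with $\{u\}$. Three distinct vertices form a rainbow triangle if one can pick pairwise distinct colors from the three color sets of its sides. $(G,\rho)$ is Gallai if it has no rainbow triangle; maximal if for every pair $u,v$ and color $B\notin\rho[uv]$, adding $B$ to $\rho[uv]$ would create a rainbow triangle; reduced if there is no pair $u,v$ with $\rho[uw]=\rho[vw]$ and $|\rho[uw]|=1$ for all $w\notin\{u,v\}$. Dominance: for disjoint nonempty $U,V\subseteq\mathcal V$, $U\triangleright V$ iff $|\rho[UV]|>1$ and either (a) $U=\{u\}$, $V=\{v\}$, $u<v$, or (b) $|U|>1$ or $|V|>1$, and $\rho[uv]=\rho[uV]$ for all $u\in U,v\in V$. The signature $\Sigma(U,V)$ is the map $u\mapsto\rho[uV]$ on $U$. Mixed graphs: complete means each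 pair of distinct vertices is joined by exactly one edge, undirected or directed (one direction). Weak components are the components of the graph given by the directed edges with directions forgotten (undirected edges ignored). A rooted tree is a transitive directed graph whose transitive reduction is a tree; its root is the unique vertex with a directed edge to every other vertex. For an induced subgraph $H$ define $M_n(H)=(\mathcal V_n,\mathcal E_n,\mathcal A_n)$: $\mathcal V_0=V(H)$, $\mathcal A_0=\{(u,v):u\triangleright v\}$, $\mathcal E_0=\{\{u,v\}:|\rho[uv]|=1\}$; for $n\ge1$, $\mathcal V_n$ is the partition of $V(H)$ whose blocks are the unions of the members of $\mathcal V_{n-1}$ lying in one weak component of $M_{n-1}(H)$, $\mathcal A_n=\{(U,W)\in\mathcal V_n^2:U\triangleright W\}$, $\mathcal E_n=\{\{U,W\}:U\neq W,\ |\rho[UW]|=1\}$. $H$ has the tree property for $n$ if for every $k\le n$: $M_k(H)$ is complete; $|\rho[UW]|=1$ on $\mathcal E_k$ and $=2$ on $\mathcal A_k$; every weak component of $M_k(H)$ with its directed edges is a rooted tree; and $(U,V),(V,W)\in\mathcal A_k$ implies $\Sigma(U,V)=\Sigma(U,W)$. Root notation (given the tree property for $n$): for $1\le k\le n+1$ and $U\in\mathcal V_k$, $\mathrm{tr}(U)$ is the set of members of $\mathcal V_{k-1}$ contained in $U$ (a weak component of $M_{k-1}(H)$) and $\mathrm{rt}(U)\in\mathcal V_{k-1}$ is its root. Iterating $\mathrm{rt}$ down to level $0$ yields a single vertex $\mathrm{brt}(U)$ (for $U=\{u\}\in\mathcal V_0$, $\mathrm{brt}(U)=u$). Tree colors: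 for $u\in\mathcal V_0$, $\mathrm{tc}(u)=\bigcup\{\rho[uv]:v\in V(H),\ u\triangleright v\}$; for $U\in\mathcal V_k$ with $k\ge1$, $\mathrm{tc}(U)=\mathrm{tc}(\mathrm{rt}(U))$. -}

module Defs where

open import Data.Nat using (ℕ; zero; suc; _<_; _≤_; _≟_)
open import Data.List using (List; []; _∷_)
open import Data.List.Membership.Propositional using (_∈_; _∉_)
open import Data.Product using (Σ; ∃; _×_; _,_)
open import Data.Sum using (_⊎_)
open import Data.Bool using (if_then_else_; _∧_; _∨_)
open import Data.Empty using (⊥)
open import Relation.Nullary using (¬_)
open import Relation.Nullary.Decidable using (⌊_⌋)
open import Relation.Binary.PropositionalEquality using (_≡_; _≢_)
open import Relation.Binary.Construct.Closure.Equivalence using (EqClosure)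
open import Relation.Binary.Construct.Closure.ReflexiveTransitive using (Star)

-- Conventions
-- Vertices are natural numbers, colors are natural numbers, a finite
-- color set is a list of colors (read as the set of its members).

VSet : Set₁
VSet = ℕ → Set

CSet : Set₁
CSet = ℕ → Set

Coloring : Set
Coloring = ℕ → ℕ → List ℕ

_⇔_ : Set → Set → Set
A ⇔ B = (A → B) × (B → A)

_≐_ : CSet → CSet → Set
P ≐ Q = ∀ c → P c ⇔ Q c

Card1 : CSet → Set
Card1 P = Σ ℕ λ c → P c × (∀ d → P d → d ≡ c)

CardGt1 : CSet → Set
CardGt1 P = Σ ℕ λ c → Σ ℕ λ d → c ≢ d × P c × P d

Card2 : CSet → Set
Card2 P = Σ ℕ λ c → Σ ℕ λ d → c ≢ d × P c × P d × (∀ e → P e → e ≡ c ⊎ e ≡ d)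

col : Coloring → ℕ → ℕ → CSet
col ρ u v c = c ∈ ρ u v

record Multigraph : Set where
  field
    V      : List ℕ
    ρ      : Coloring
    ρ-sym  : ∀ u v c → c ∈ ρ u v → c ∈ ρ v u
    ρ-ne   : ∀ u v → u ∈ V → v ∈ V → u ≢ v → Σ ℕ λ c → c ∈ ρ u v
open Multigraph public

RainbowTriangle : List ℕ → Coloring → ℕ → ℕ → ℕ → Set
RainbowTriangle V ρ u v w =
  u ∈ V × v ∈ V × w ∈ V × u ≢ v × v ≢ w × u ≢ w ×
  Σ ℕ λ a → Σ ℕ λ b → Σ ℕ λ c →
    a ∈ ρ u v × b ∈ ρ v w × c ∈ ρ u w × a ≢ b × b ≢ c × a ≢ c

HasRainbow : List ℕ → Coloring → Set
HasRainbow V ρ = Σ ℕ λ u → Σ ℕ λ v → Σ ℕ λ w → RainbowTriangle V ρ u v w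

Gallai : Multigraph → Set
Gallai G = ¬ HasRainbow (V G) (ρ G)

addColor : Coloring → ℕ → ℕ → ℕ → Coloring
addColor ρ u v B a b =
  if (⌊ a ≟ u ⌋ ∧ ⌊ b ≟ v ⌋) ∨ (⌊ a ≟ v ⌋ ∧ ⌊ b ≟ u ⌋)
  then B ∷ ρ a b else ρ a b

Maximal : Multigraph → Set
Maximal G = ∀ u v B → u ∈ V G → v ∈ V G → u ≢ v → B ∉ ρ G u v →
  HasRainbow (V G) (addColor (ρ G) u v B)

Reduced : Multigraph → Set
Reduced G = ¬ (Σ ℕ λ u → Σ ℕ λ v → u ∈ V G × v ∈ V G × u ≢ v ×
  (∀ w → w ∈ V G → w ≢ u → w ≢ v →
     (col (ρ G) u w ≐ col (ρ G) v w) × Card1 (col (ρ G) u w)))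

Single : ℕ → VSet
Single u y = y ≡ u

cols : Coloring → VSet → VSet → CSet
cols ρ U W c = Σ ℕ λ u → Σ ℕ λ w → U u × W w × u ≢ w × c ∈ ρ u w

IsSingletonOf : VSet → ℕ → Set
IsSingletonOf U u = ∀ y → U y ⇔ (y ≡ u)

Big : VSet → Set
Big U = Σ ℕ λ a → Σ ℕ λ b → a ≢ b × U a × U b

NonEmpty : VSet → Set
NonEmpty U = Σ ℕ λ y → U y

Disjoint : VSet → VSet → Set
Disjoint U W = ∀ y → U y → W y → ⊥

Dom : Coloring → VSet → VSet → Set
Dom ρ U W = Disjoint U W × NonEmpty U × NonEmpty W × CardGt1 (cols ρ U W) ×
  ( (Σ ℕ λ u → Σ ℕ λ w → IsSingletonOf U u × IsSingletonOf W w × u < w)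
  ⊎ ((Big U ⊎ Big W) ×
     (∀ u w → U u → W w → col ρ u w ≐ cols ρ (Single u) W)))

-- Blocks of the partition 𝒱_k are represented by representatives:
-- Same k x y  means x,y lie in the same member of 𝒱_k,
-- blk k x     is the member of 𝒱_k containing x,
-- Arc k x y   means (blk k x , blk k y) ∈ 𝒜_k.

module Levels (ρ : Coloring) (inH : VSet) where

  mutual
    Same : ℕ → ℕ → ℕ → Set
    Same zero x y = x ≡ y
    Same (suc n) x y = EqClosure (Step n) x y

    -- one step of weak connectivity in M_n(H) (inside a block, or a directed edge)
    Step : ℕ → ℕ → ℕ → Set
    Step n x y = inH x × inH y × (Same n x y ⊎ Arc n x y)

    blk : ℕ → ℕ → VSet
    blk n x y = inH y × Same n x y

    Arc : ℕ → ℕ → ℕ → Set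
    Arc n x y = Dom ρ (blk n x) (blk n y)

  Complete : ℕ → Set
  Complete k = ∀ x y → inH x → inH y → ¬ Same k x y →
    (Card1 (cols ρ (blk k x) (blk k y)) ⊎ Arc k x y ⊎ Arc k y x) ×
    ¬ (Arc k x y × Arc k y x)

  ArcCard2 : ℕ → Set
  ArcCard2 k = ∀ x y → inH x → inH y → Arc k x y →
    Card2 (cols ρ (blk k x) (blk k y))

  -- vertices (blocks of level k) of the weak component of M_k(H) containing x
  InComp : ℕ → ℕ → ℕ → Set
  InComp k x y = inH y × Same (suc k) x y

  -- transitive reduction of the arcs inside the component
  Red : ℕ → ℕ → ℕ → ℕ → Set
  Red k x a b = Arc k a b × ¬ (Σ ℕ λ c → InComp k x c × Arc k a c × Arc k c b)

  -- the weak component of M_k(H) containing x, with its directed edges,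
  -- is a rooted tree: transitive (and loopless), and its transitive
  -- reduction is a tree directed away from a root (arborescence)
  RootedTreeComp : ℕ → ℕ → Set
  RootedTreeComp k x =
    (∀ a b c → InComp k x a → InComp k x b → InComp k x c →
       Arc k a b → Arc k b c → Arc k a c) ×
    (∀ a → InComp k x a → ¬ Arc k a a) ×
    (Σ ℕ λ r → InComp k x r ×
       (∀ a → InComp k x a → ¬ Red k x a r) ×
       (∀ v → InComp k x v → ¬ Same k v r →
          Σ ℕ λ a → InComp k x a × Red k x a v ×
            (∀ a' → InComp k x a' → Red k x a' v → Same k a a')) ×
       (∀ v → InComp k x v →
          Star (λ a b → InComp k x a × InComp k x b × (Same k a b ⊎ Red k x a b)) r v))

  SigCond : ℕ → Set
  SigCond k = ∀ x y z → inH x → inH y → inH z → Arc k x y → Arc k y z →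
    ∀ u → blk k x u → cols ρ (Single u) (blk k y) ≐ cols ρ (Single u) (blk k z)

  TreeProperty : ℕ → Set
  TreeProperty n = ∀ k → k ≤ n →
    Complete k × ArcCard2 k × (∀ x → inH x → RootedTreeComp k x) × SigCond k

  -- r represents rt(blk (suc k) x): the vertex of the weak component with
  -- a directed edge to every other vertex
  IsRoot : ℕ → ℕ → ℕ → Set
  IsRoot k x r = InComp k x r ×
    (∀ y → InComp k x y → ¬ Same k r y → Arc k r y)

  IsBrt : ℕ → ℕ → ℕ → Set
  IsBrt zero x b = b ≡ x
  IsBrt (suc k) x b = Σ ℕ λ r → IsRoot k x r × IsBrt k r b

  tcv : ℕ → CSet
  tcv u c = Σ ℕ λ v → inH v × Dom ρ (Single u) (Single v) × c ∈ ρ u v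

  TC : ℕ → ℕ → CSet
  TC zero x = tcv x
  TC (suc k) x c = Σ ℕ λ r → IsRoot k x r × TC k r c

module Submission where

-- Unfolding tc(U) along the roots gives tc(b): two roots of one component
-- lie in one block, since otherwise they would be joined by arcs in both
-- directions, contradicting completeness.  One inclusion is then immediate,
-- because b ▷ v puts v into the block of b.  For the other, descend the
-- levels: an edge b u with u outside the block of the level-k root lies in
-- an arc of M_k(H) leaving that block, so it suffices that every color of
-- an arc R ▷ W with brt R = b lies in tc(b) (ArcClaim).  This is proved by
-- induction on the level together with SecondColorClaim: on level k+1 the
-- arc has exactly two colors, one of them is the single color g of the
-- edge b w (w ∈ W), and the other one is reached by descending through the
-- root blocks, where Gallai triangles confine the arc colors to {g, h}.
--
-- Case splits on block membership are classical;
-- they are admissible because "c ∈ tc(b)" is decidable, hence stable.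

open import Defs
open import Data.Nat using (ℕ; zero; suc; _<_; _≤_; _≟_; _<?_; z≤n)
open import Data.Nat.Properties using (≤-refl; <-irrefl; <⇒≤; ≤-pred)
open import Data.List using (List)
open import Data.List.Membership.Propositional using (_∈_; find; lose)
open import Data.List.Membership.DecPropositional _≟_ using (_∈?_)
open import Data.List.Relation.Unary.Any using (Any; any?)
open import Data.Product using (Σ; _×_; _,_; proj₁; proj₂)
open import Data.Sum using (_⊎_; inj₁; inj₂)
open import Data.Empty using (⊥-elim)
open import Function using (_∘_)
open import Relation.Nullary using (¬_; Dec; yes; no; ¬?; Stable; map′; _×-dec_; decidable-stable)
open import Relation.Binary.PropositionalEquality using (_≡_; _≢_; refl; sym; trans)
open import Relation.Binary.Construct.Closure.ReflexiveTransitive using (ε; _◅_; _◅◅_)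
open import Relation.Binary.Construct.Closure.Symmetric using (fwd; bwd)
import Relation.Binary.Construct.Closure.Equivalence as EqClosure

by-cases : {A B : Set} → Stable B → (A → B) → (¬ A → B) → B
by-cases stable yes-case no-case = stable λ ¬b → ¬b (no-case (¬b ∘ yes-case))

cover-pair : {P : ℕ → Set} {c₁ c₂ g h : ℕ} → c₁ ≢ c₂ →
  c₁ ≡ g ⊎ c₁ ≡ h → c₂ ≡ g ⊎ c₂ ≡ h → P c₁ → P c₂ → P g × P h
cover-pair c₁≢c₂ (inj₁ refl) (inj₁ refl) _ _ = ⊥-elim (c₁≢c₂ refl)
cover-pair _ (inj₁ refl) (inj₂ refl) p₁ p₂ = p₁ , p₂
cover-pair _ (inj₂ refl) (inj₁ refl) p₁ p₂ = p₂ , p₁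
cover-pair c₁≢c₂ (inj₂ refl) (inj₂ refl) _ _ = ⊥-elim (c₁≢c₂ refl)

cardGt1? : (L : List ℕ) → Dec (CardGt1 (_∈ L))
cardGt1? L = map′ from-any to-any (any? (λ c → any? (λ d → ¬? (c ≟ d)) L) L)
  where
  from-any : Any (λ c → Any (λ d → c ≢ d) L) L → CardGt1 (_∈ L)
  from-any a with find a
  ... | c , c∈ , a′ with find a′
  ...   | d , d∈ , c≢d = c , d , c≢d , c∈ , d∈
  to-any : CardGt1 (_∈ L) → Any (λ c → Any (λ d → c ≢ d) L) L
  to-any (c , d , c≢d , c∈ , d∈) = lose c∈ (lose d∈ c≢d)

_≡ᵥ_ : VSet → VSet → Set
U ≡ᵥ U′ = ∀ y → U y ⇔ U′ y

≡ᵥ-sym : {U U′ : VSet} → U ≡ᵥ U′ → U′ ≡ᵥ U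
≡ᵥ-sym e y = proj₂ (e y) , proj₁ (e y)

≡ᵥ-refl : {U : VSet} → U ≡ᵥ U
≡ᵥ-refl y = (λ z → z) , (λ z → z)

cols-resp : {ρ : Coloring} {U U′ W W′ : VSet} → U ≡ᵥ U′ → W ≡ᵥ W′ →
  ∀ c → cols ρ U W c → cols ρ U′ W′ c
cols-resp eU eW c (u , w , u∈ , w∈ , u≢w , c∈) =
  u , w , proj₁ (eU u) u∈ , proj₁ (eW w) w∈ , u≢w , c∈

singleton-resp : {U U′ : VSet} {u : ℕ} → U ≡ᵥ U′ → IsSingletonOf U u → IsSingletonOf U′ u
singleton-resp e s y = proj₁ (s y) ∘ proj₂ (e y) , proj₁ (e y) ∘ proj₂ (s y)

big-resp : {U U′ : VSet} → U ≡ᵥ U′ → Big U → Big U′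
big-resp e (a , a′ , a≢a′ , a∈ , a′∈) = a , a′ , a≢a′ , proj₁ (e a) a∈ , proj₁ (e a′) a′∈

Dom-resp : {ρ : Coloring} {U U′ W W′ : VSet} → U ≡ᵥ U′ → W ≡ᵥ W′ → Dom ρ U W → Dom ρ U′ W′
Dom-resp {ρ} {U} {U′} {W} {W′} eU eW (disj , (a , a∈) , (b , b∈) , (c , d , c≢d , c∈ , d∈) , kind) =
  (λ y y∈U′ y∈W′ → disj y (proj₂ (eU y) y∈U′) (proj₂ (eW y) y∈W′)) ,
  (a , proj₁ (eU a) a∈) , (b , proj₁ (eW b) b∈) ,
  (c , d , c≢d , cols-resp eU eW c c∈ , cols-resp eU eW d d∈) , kind′ kind
  where
  uniform′ : (∀ u w → U u → W w → col ρ u w ≐ cols ρ (Single u) W) →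
    ∀ u w → U′ u → W′ w → col ρ u w ≐ cols ρ (Single u) W′
  uniform′ uniform u w u∈ w∈ c =
    cols-resp ≡ᵥ-refl eW c ∘ proj₁ (same c) , proj₂ (same c) ∘ cols-resp ≡ᵥ-refl (≡ᵥ-sym eW) c
    where
    same : col ρ u w ≐ cols ρ (Single u) W
    same = uniform u w (proj₂ (eU u) u∈) (proj₂ (eW w) w∈)
  kind′ : (Σ ℕ λ u → Σ ℕ λ w → IsSingletonOf U u × IsSingletonOf W w × u < w)
    ⊎ ((Big U ⊎ Big W) × (∀ u w → U u → W w → col ρ u w ≐ cols ρ (Single u) W)) →
    (Σ ℕ λ u → Σ ℕ λ w → IsSingletonOf U′ u × IsSingletonOf W′ w × u < w)
    ⊎ ((Big U′ ⊎ Big W′) × (∀ u w → U′ u → W′ w → col ρ u w ≐ cols ρ (Single u) W′))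
  kind′ (inj₁ (u , w , su , sw , u<w)) = inj₁ (u , w , singleton-resp eU su , singleton-resp eW sw , u<w)
  kind′ (inj₂ (inj₁ bigU , uniform)) = inj₂ (inj₁ (big-resp eU bigU) , uniform′ uniform)
  kind′ (inj₂ (inj₂ bigW , uniform)) = inj₂ (inj₂ (big-resp eW bigW) , uniform′ uniform)

dom-singletons⇒ : {ρ : Coloring} {u v : ℕ} → Dom ρ (Single u) (Single v) → u < v × CardGt1 (col ρ u v)
dom-singletons⇒ {ρ} {u} {v}
  (_ , _ , _ , (c , d , c≢d , (_ , _ , refl , refl , _ , c∈) , (_ , _ , refl , refl , _ , d∈)) ,
   inj₁ (u₀ , v₀ , su , sv , u₀<v₀))
  with proj₁ (su u) refl | proj₁ (sv v) refl
... | refl | refl = u₀<v₀ , c , d , c≢d , c∈ , d∈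
dom-singletons⇒ (_ , _ , _ , _ , inj₂ (inj₁ (_ , _ , a≢a′ , refl , refl) , _)) = ⊥-elim (a≢a′ refl)
dom-singletons⇒ (_ , _ , _ , _ , inj₂ (inj₂ (_ , _ , a≢a′ , refl , refl) , _)) = ⊥-elim (a≢a′ refl)

dom-singletons⇐ : {ρ : Coloring} {u v : ℕ} → u < v × CardGt1 (col ρ u v) → Dom ρ (Single u) (Single v)
dom-singletons⇐ {ρ} {u} {v} (u<v , c , d , c≢d , c∈ , d∈) =
  (λ { _ refl refl → <-irrefl refl u<v }) , (u , refl) , (v , refl) ,
  (c , d , c≢d , (u , v , refl , refl , u≢v , c∈) , (u , v , refl , refl , u≢v , d∈)) ,
  inj₁ (u , v , ≡ᵥ-refl , ≡ᵥ-refl , u<v)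
  where
  u≢v : u ≢ v
  u≢v refl = <-irrefl refl u<v

tcv-stable : (ρ : Coloring) (VH : List ℕ) → ∀ u c → Stable (Levels.tcv ρ (_∈ VH) u c)
tcv-stable ρ VH u c = decidable-stable (map′ from-any to-any (any? arc-with-c? VH))
  where
  ArcWithC : ℕ → Set
  ArcWithC v = (u < v × CardGt1 (col ρ u v)) × c ∈ ρ u v
  arc-with-c? : ∀ v → Dec (ArcWithC v)
  arc-with-c? v = (u <? v ×-dec cardGt1? (ρ u v)) ×-dec c ∈? ρ u v
  from-any : Any ArcWithC VH → Levels.tcv ρ (_∈ VH) u c
  from-any a with find a
  ... | v , v∈ , dom , c∈ = v , v∈ , dom-singletons⇐ dom , c∈
  to-any : Levels.tcv ρ (_∈ VH) u c → Any ArcWithC VH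
  to-any (v , v∈ , dom , c∈) = lose v∈ (dom-singletons⇒ dom , c∈)

third-side : (G : Multigraph) → Gallai G → ∀ {v u w g h c} →
  v ∈ V G → u ∈ V G → w ∈ V G → v ≢ u → u ≢ w → v ≢ w →
  g ∈ ρ G v w → h ∈ ρ G u w → h ≢ g → c ∈ ρ G v u → c ≡ g ⊎ c ≡ h
third-side G gal {v} {u} {w} {g} {h} {c} v∈ u∈ w∈ v≢u u≢w v≢w g∈ h∈ h≢g c∈ with c ≟ g | c ≟ h
... | yes c≡g | _ = inj₁ c≡g
... | no _ | yes c≡h = inj₂ c≡h
... | no c≢g | no c≢h =
  ⊥-elim (gal (v , u , w , v∈ , u∈ , w∈ , v≢u , u≢w , v≢w , c , h , g , c∈ , h∈ , g∈ , c≢h , h≢g , c≢g))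

module LevelFacts (ρ : Coloring) (inH : VSet) where
  open Levels ρ inH

  same-refl : ∀ k x → Same k x x
  same-refl zero x = refl
  same-refl (suc k) x = ε

  same-sym : ∀ k {x y} → Same k x y → Same k y x
  same-sym zero = sym
  same-sym (suc k) = EqClosure.symmetric (Step k)

  same-trans : ∀ k {x y z} → Same k x y → Same k y z → Same k x z
  same-trans zero = trans
  same-trans (suc k) = _◅◅_

  same-in : ∀ k {x y} → Same k x y → inH x → inH y
  same-in zero refl x∈ = x∈
  same-in (suc k) ε x∈ = x∈
  same-in (suc k) (fwd (_ , z∈ , _) ◅ p) _ = same-in (suc k) p z∈
  same-in (suc k) (bwd (z∈ , _ , _) ◅ p) _ = same-in (suc k) p z∈

  same-up : ∀ k {x y} → inH x → Same k x y → Same (suc k) x y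
  same-up k x∈ s = fwd (x∈ , same-in k s x∈ , inj₁ s) ◅ ε

  same-from-1 : ∀ k {x y} → inH x → Same 1 x y → Same (suc k) x y
  same-from-1 zero x∈ s = s
  same-from-1 (suc k) x∈ s = same-up (suc k) x∈ (same-from-1 k x∈ s)

  blk-mono : ∀ k {y r v} → Same (suc k) y r → inH r → blk k r v → blk (suc k) y v
  blk-mono k syr r∈ (v∈ , srv) = v∈ , same-trans (suc k) syr (same-up k r∈ srv)

  outside-distinct : ∀ k {y v w} → blk k y v → ¬ Same k y w → v ≢ w
  outside-distinct k (_ , syv) nw refl = nw syv

  brt-in : ∀ k {y b} → inH y → IsBrt k y b → blk k y b
  brt-in zero y∈ refl = y∈ , refl
  brt-in (suc k) _ (r , ((r∈ , syr) , _) , brt) = blk-mono k syr r∈ (brt-in k r∈ brt)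

  blk0≡single : ∀ {x} → inH x → blk 0 x ≡ᵥ Single x
  blk0≡single x∈ y = (λ { (_ , refl) → refl }) , (λ { refl → x∈ , refl })

  arc0⇒dom : ∀ {r u} → inH r → inH u → Arc 0 r u → Dom ρ (Single r) (Single u)
  arc0⇒dom r∈ u∈ = Dom-resp (blk0≡single r∈) (blk0≡single u∈)

  dom-joins : ∀ {b v} → inH b → inH v → Dom ρ (Single b) (Single v) → Same 1 b v
  dom-joins b∈ v∈ dom =
    fwd (b∈ , v∈ , inj₂ (Dom-resp (≡ᵥ-sym (blk0≡single b∈)) (≡ᵥ-sym (blk0≡single v∈)) dom)) ◅ ε

  arc-apart : ∀ k {r u} → Arc k r u → inH u → ¬ Same k r u
  arc-apart k (disj , _) u∈ sru = disj _ (u∈ , sru) (u∈ , same-refl k _)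

  arc-two-colors : ∀ k {r u} → Arc k r u → CardGt1 (cols ρ (blk k r) (blk k u))
  arc-two-colors k (_ , _ , _ , two , _) = two

  Occurs : ℕ → ℕ → ℕ → ℕ → Set
  Occurs k y w c = Σ ℕ λ v → blk k y v × c ∈ ρ v w

  occurs-at-target : ∀ k {r u c} → Arc k r u → inH u →
    cols ρ (blk k r) (blk k u) c → Occurs k r u c
  occurs-at-target k (_ , _ , _ , _ , inj₁ (_ , _ , _ , su , _)) u∈ (v , x , v∈ , x∈ , _ , c∈)
    with proj₁ (su x) x∈ | proj₁ (su _) (u∈ , same-refl k _)
  ... | refl | refl = v , v∈ , c∈
  occurs-at-target k {c = c} (disj , _ , _ , _ , inj₂ (_ , uniform)) u∈ (v , x , v∈ , x∈ , _ , c∈) =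
    v , v∈ , proj₂ (uniform v _ v∈ (u∈ , same-refl k _) c) (v , x , refl , x∈ , v≢x , c∈)
    where
    v≢x : v ≢ x
    v≢x refl = disj v v∈ x∈

  TC-resp : ∀ k {a a′ c} → Same k a a′ → TC k a c → TC k a′ c
  TC-resp zero refl t = t
  TC-resp (suc k) saa′ (r , ((r∈ , sar) , root-arc) , t) =
    r , ((r∈ , same-trans (suc k) (same-sym (suc k) saa′) sar) ,
         (λ y (y∈ , sa′y) → root-arc y (y∈ , same-trans (suc k) saa′ sa′y))) , t

  tc-of-brt⇒tc : ∀ k {y b c} → IsBrt k y b → tcv b c → TC k y c
  tc-of-brt⇒tc zero refl t = t
  tc-of-brt⇒tc (suc k) (r , root , brt) t = r , root , tc-of-brt⇒tc k brt t

module TreeColors (G : Multigraph) (gal : Gallai G) (VH : List ℕ)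
                  (sub : ∀ v → v ∈ VH → v ∈ V G) (n : ℕ)
                  (complete : ∀ k → k ≤ n → Levels.Complete (ρ G) (_∈ VH) k)
                  (card2 : ∀ k → k ≤ n → Levels.ArcCard2 (ρ G) (_∈ VH) k) where
  open Levels (ρ G) (_∈ VH)
  open LevelFacts (ρ G) (_∈ VH)

  ρ′ : Coloring
  ρ′ = ρ G

  TcPair : ℕ → ℕ → ℕ → Set
  TcPair b g h = tcv b g × tcv b h

  stable : ∀ {b c} → Stable (tcv b c)
  stable = tcv-stable ρ′ VH _ _

  pair-stable : ∀ {b g h} → Stable (TcPair b g h)
  pair-stable nn = stable (λ ¬g → nn (¬g ∘ proj₁)) , stable (λ ¬h → nn (¬h ∘ proj₂))

  ColorsIn : ℕ → ℕ → ℕ → ℕ → ℕ → Set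
  ColorsIn k y w g h = ∀ v → blk k y v → ∀ c → c ∈ ρ′ v w → c ≡ g ⊎ c ≡ h

  single-color : ∀ {b w} → b ∈ VH → w ∈ VH → b ≢ w → ¬ Same 1 b w →
    Σ ℕ λ g → g ∈ ρ′ b w × (∀ d → d ∈ ρ′ b w → d ≡ g)
  single-color {b} {w} b∈ w∈ b≢w apart with proj₁ (complete 0 z≤n b w b∈ w∈ b≢w)
  ... | inj₁ (g , (_ , _ , (_ , refl) , (_ , refl) , _ , g∈) , only) =
        g , g∈ , λ d d∈ → only d (b , w , (b∈ , refl) , (w∈ , refl) , b≢w , d∈)
  ... | inj₂ (inj₁ arc) = ⊥-elim (apart (fwd (b∈ , w∈ , inj₂ arc) ◅ ε))
  ... | inj₂ (inj₂ arc) = ⊥-elim (apart (bwd (w∈ , b∈ , inj₂ arc) ◅ ε))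

  roots-coincide : ∀ k → k ≤ n → ∀ {y r r′} → IsRoot k y r → IsRoot k y r′ → ¬ ¬ Same k r r′
  roots-coincide k le ((r∈ , syr) , root-arc) ((r′∈ , syr′) , root-arc′) r≁r′ =
    proj₂ (complete k le _ _ r∈ r′∈ r≁r′)
      (root-arc _ (r′∈ , syr′) r≁r′ , root-arc′ _ (r∈ , syr) (r≁r′ ∘ same-sym k))

  ArcClaim : ℕ → Set
  ArcClaim k = ∀ {r u b} → r ∈ VH → u ∈ VH → IsBrt k r b → Arc k r u →
    ∀ c → cols ρ′ (blk k r) (blk k u) c → tcv b c

  SecondColorClaim : ℕ → Set
  SecondColorClaim k = ∀ {y b w g h} → IsBrt k y b → w ∈ VH → ¬ Same k y w → h ≢ g →
    ColorsIn k y w g h → (∀ d → d ∈ ρ′ b w → d ≡ g) →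
    ∀ u → blk k y u → h ∈ ρ′ u w → TcPair b g h

  arc-colors-base : ArcClaim 0
  arc-colors-base r∈ u∈ refl arc c (_ , _ , (_ , refl) , (_ , refl) , _ , c∈) =
    _ , u∈ , arc0⇒dom r∈ u∈ arc , c∈

  -- on level 0 the block is {b}, so h would be the color g of b w
  second-color-base : SecondColorClaim 0
  second-color-base refl _ _ h≢g _ only-g _ (_ , refl) h∈ = ⊥-elim (h≢g (only-g _ h∈))

  -- Descent through the root block R₀ of Y.  If u ∈ R₀, use the claim on
  -- level k.  Otherwise R₀ ▷ (block of u); each of its two colors c, seen
  -- on an edge v u with v ∈ R₀, is g or h: either v sees w in color h (and
  -- the level-k claim applies), or v w has color g and the Gallai triangle
  -- v u w forces c ∈ {g, h}.  Then the arc claim on level k finishes.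
  second-color-step : ∀ k → ArcClaim k → SecondColorClaim k → SecondColorClaim (suc k)
  second-color-step k arc-claim second-claim {y} {b} {w} {g} {h} (r , ((r∈ , syr) , root-arc) , brt)
                    w∈ y≁w h≢g colors only-g u (u∈ , syu) h∈ =
    by-cases pair-stable (λ sru → in-root-block u sru h∈) outside-root-block
    where
    root⊆Y : ∀ {v} → blk k r v → blk (suc k) y v
    root⊆Y = blk-mono k syr r∈

    in-root-block : ∀ v → Same k r v → h ∈ ρ′ v w → TcPair b g h
    in-root-block v srv h∈′ =
      second-claim brt w∈ (λ srw → y≁w (proj₂ (root⊆Y (w∈ , srw)))) h≢g
        (λ v′ → colors v′ ∘ root⊆Y) only-g v (same-in k srv r∈ , srv) h∈′

    by-side-color : ∀ {v c s} → blk k r v → c ∈ ρ′ v u → ¬ Same k r u → s ∈ ρ′ v w →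
      s ≡ g ⊎ s ≡ h → TcPair b g h ⊎ (c ≡ g ⊎ c ≡ h)
    by-side-color (_ , srv) _ _ s∈ (inj₂ refl) = inj₁ (in-root-block _ srv s∈)
    by-side-color {v} (v∈ , srv) c∈ r≁u s∈ (inj₁ refl) =
      inj₂ (third-side G gal (sub v v∈) (sub u u∈) (sub w w∈)
              (outside-distinct k (v∈ , srv) r≁u)
              (outside-distinct (suc k) (u∈ , syu) y≁w)
              (outside-distinct (suc k) (root⊆Y (v∈ , srv)) y≁w) s∈ h∈ h≢g c∈)

    classify : ∀ {c} → ¬ Same k r u → Occurs k r u c → TcPair b g h ⊎ (c ≡ g ⊎ c ≡ h)
    classify r≁u (v , v∈ , c∈) =
      by-side-color v∈ c∈ r≁u (proj₂ side) (colors v (root⊆Y v∈) _ (proj₂ side))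
      where
      side : Σ ℕ λ s → s ∈ ρ′ v w
      side = ρ-ne G v w (sub v (proj₁ v∈)) (sub w w∈) (outside-distinct (suc k) (root⊆Y v∈) y≁w)

    outside-root-block : ¬ Same k r u → TcPair b g h
    outside-root-block r≁u = covered (arc-two-colors k arc)
      where
      arc : Arc k r u
      arc = root-arc u (u∈ , syu) r≁u
      kind : ∀ {c} → cols ρ′ (blk k r) (blk k u) c → TcPair b g h ⊎ (c ≡ g ⊎ c ≡ h)
      kind c∈ = classify r≁u (occurs-at-target k arc u∈ c∈)
      covered : CardGt1 (cols ρ′ (blk k r) (blk k u)) → TcPair b g h
      covered (c₁ , c₂ , c₁≢c₂ , c₁∈ , c₂∈) with kind c₁∈ | kind c₂∈
      ... | inj₁ res | _ = res
      ... | inj₂ _ | inj₁ res = res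
      ... | inj₂ e₁ | inj₂ e₂ =
        cover-pair c₁≢c₂ e₁ e₂ (arc-claim r∈ u∈ brt arc _ c₁∈) (arc-claim r∈ u∈ brt arc _ c₂∈)

  -- If the edge b w, from b = brt Y to a vertex w outside Y, has a single
  -- color, and the edges from Y to w use exactly the colors p ≠ q, then
  -- both lie in tc(b): the single color is one of them, say g, and the
  -- second-color claim gives the other.
  two-colored-in-tc : ∀ k → SecondColorClaim k → ∀ {y b w p q} → blk k y b → IsBrt k y b →
    w ∈ VH → ¬ Same k y w → p ≢ q → ColorsIn k y w p q →
    (Σ ℕ λ g → g ∈ ρ′ b w × (∀ d → d ∈ ρ′ b w → d ≡ g)) →
    Occurs k y w p → Occurs k y w q → TcPair b p q
  two-colored-in-tc k second-claim {y} {b} {w} {p} {q} b∈Y brt w∈ y≁w p≢q colors (g , g∈ , only-g)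
                    (u₁ , u₁∈ , p∈) (u₂ , u₂∈ , q∈)
    with colors b b∈Y g g∈
  ... | inj₁ refl = second-claim brt w∈ y≁w (p≢q ∘ sym) colors only-g u₂ u₂∈ q∈
  ... | inj₂ refl = swap (second-claim brt w∈ y≁w p≢q colors′ only-g u₁ u₁∈ p∈)
    where
    swap : TcPair b q p → TcPair b p q
    swap (tq , tp) = tp , tq
    colors′ : ColorsIn k y w q p
    colors′ v v∈ d d∈ with colors v v∈ d d∈
    ... | inj₁ d≡p = inj₂ d≡p
    ... | inj₂ d≡q = inj₁ d≡q

  -- An arc R ▷ W on level k+1 ≤ n has exactly two colors p, q, and every
  -- vertex u of W sees R in both; b = brt R and u are in different
  -- components of M_0(H), so b u has a single color.
  arc-colors-step : ∀ k → suc k ≤ n → SecondColorClaim (suc k) → ArcClaim (suc k)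
  arc-colors-step k le second-claim {r} {u} {b} r∈ u∈ brt arc c c∈
    with card2 (suc k) le r u r∈ u∈ arc
  ... | p , q , p≢q , p∈ , q∈ , only =
    pick (only c c∈) (two-colored-in-tc (suc k) second-claim b∈R brt u∈ r≁u p≢q colors single
                        (occurs-at-target (suc k) arc u∈ p∈) (occurs-at-target (suc k) arc u∈ q∈))
    where
    r≁u : ¬ Same (suc k) r u
    r≁u = arc-apart (suc k) arc u∈
    b∈R : blk (suc k) r b
    b∈R = brt-in (suc k) r∈ brt
    single : Σ ℕ λ g → g ∈ ρ′ b u × (∀ d → d ∈ ρ′ b u → d ≡ g)
    single = single-color (proj₁ b∈R) u∈ (outside-distinct (suc k) b∈R r≁u)
               (r≁u ∘ same-trans (suc k) (proj₂ b∈R) ∘ same-from-1 k (proj₁ b∈R))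
    colors : ColorsIn (suc k) r u p q
    colors v v∈ d d∈ =
      only d (v , u , v∈ , (u∈ , same-refl (suc k) u) , outside-distinct (suc k) v∈ r≁u , d∈)
    pick : c ≡ p ⊎ c ≡ q → TcPair b p q → tcv b c
    pick (inj₁ refl) (tp , _) = tp
    pick (inj₂ refl) (_ , tq) = tq

  tree-color-claims : ∀ k → k ≤ n → ArcClaim k × SecondColorClaim k
  tree-color-claims zero _ = arc-colors-base , second-color-base
  tree-color-claims (suc k) le = arc-colors-step k le second , second
    where
    below = tree-color-claims k (<⇒≤ le)
    second = second-color-step k (proj₁ below) (proj₂ below)

  arc-colors-in-tc : ∀ k → k ≤ n → ArcClaim k
  arc-colors-in-tc k le = proj₁ (tree-color-claims k le)

  brt-edge-colors-in-tc : ∀ k → k ≤ suc n → ∀ {y b u c} → IsBrt k y b → blk k y u → u ≢ b →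
    c ∈ ρ′ b u → tcv b c
  brt-edge-colors-in-tc zero _ refl (_ , refl) u≢b _ = ⊥-elim (u≢b refl)
  brt-edge-colors-in-tc (suc k) le {b = b} {u} (r , ((r∈ , _) , root-arc) , brt) (u∈ , syu) u≢b c∈ =
    by-cases stable
      (λ sru → brt-edge-colors-in-tc k (<⇒≤ le) brt (u∈ , sru) u≢b c∈)
      (λ r≁u → arc-colors-in-tc k (≤-pred le) r∈ u∈ brt (root-arc u (u∈ , syu) r≁u) _
                 (b , u , brt-in k r∈ brt , (u∈ , same-refl k u) , u≢b ∘ sym , c∈))

  tc⇒tc-of-brt : ∀ k → k ≤ suc n → ∀ {y b c} → IsBrt k y b → TC k y c → tcv b c
  tc⇒tc-of-brt zero _ refl t = t
  tc⇒tc-of-brt (suc k) le (r , root , brt) (r′ , root′ , t) =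
    by-cases stable
      (λ srr′ → tc⇒tc-of-brt k (<⇒≤ le) brt (TC-resp k (same-sym k srr′) t))
      (λ r≁r′ → ⊥-elim (roots-coincide k (≤-pred le) root root′ r≁r′))

lemma2p7 : (G : Multigraph) → Gallai G → Maximal G → Reduced G →
    (VH : List ℕ) → (∀ v → v ∈ VH → v ∈ V G) →
    (n : ℕ) → Levels.TreeProperty (ρ G) (_∈ VH) n →
    ∀ x → x ∈ VH → ∀ b → Levels.IsBrt (ρ G) (_∈ VH) (suc n) x b →
    cols (ρ G) (Levels.blk (ρ G) (_∈ VH) (suc n) x) (Single b)
    ≐ Levels.TC (ρ G) (_∈ VH) (suc n) x
lemma2p7 G gal _ _ VH sub n tp x x∈ b brt c = to , from
  where
  open Levels (ρ G) (_∈ VH)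
  open LevelFacts (ρ G) (_∈ VH)
  open TreeColors G gal VH sub n (λ k le → proj₁ (tp k le)) (λ k le → proj₁ (proj₂ (tp k le)))

  to : cols (ρ G) (blk (suc n) x) (Single b) c → TC (suc n) x c
  to (u , _ , u∈ , refl , u≢b , c∈) =
    tc-of-brt⇒tc (suc n) brt (brt-edge-colors-in-tc (suc n) ≤-refl brt u∈ u≢b (ρ-sym G u b c c∈))

  -- an arc b ▷ v of M_0(H) puts v into the block of b
  from : TC (suc n) x c → cols (ρ G) (blk (suc n) x) (Single b) c
  from t with tc⇒tc-of-brt (suc n) ≤-refl brt t | brt-in (suc n) x∈ brt
  ... | v , v∈ , dom , c∈ | b∈ , sxb =
    v , b , (v∈ , same-trans (suc n) sxb (same-from-1 n b∈ (dom-joins b∈ v∈ dom))) ,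
    refl , (λ { refl → proj₁ dom v refl refl }) , ρ-sym G b v c c∈
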